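{- Let $\xi,\zeta\in\mathrm{IS}$ with $\xi\subseteq\zeta$, $X\in\mathbb P_\zeta$, $Y\in\mathbb P_\xi$, and $Y\subseteq X\restriction\xi$. Then $Z=X\cap(Y\restriction^{ -1}\zeta)$ belongs to $\mathbb P_\zeta$.
   Context: Fix a countable partially ordered set $I$. $\mathcal D=2^\omega$. For $\xi\subseteq I$, $\mathcal D^\xi$ is the product of $\xi$ copies of $\mathcal D$; $x\restriction\xi$ is restriction, $X\restriction\xi=\{x\restriction\xi:x\in X\}$, and for $\xi\subseteq\eta$, $X\subseteq\mathcal D^\xi$: $X\restriction^{ -1}\eta=\{y\in\mathcal D^\eta:y\restriction\xi\in X\}$. $\mathrm{IS}$ is the set of initial (downward closed) subsets of $I$. $[<i]=\{j:j<i\}$; $X\restriction_{<i}=X\restriction[<i]$. For $i\in\xi\in\mathrm{IS}$, $X\subseteq\mathcal D^\xi$, $z\in X\restriction_{<i}$: $D_{Xz}(i)=\{x(i):x\in X,x\restriction_{<i}=z\}$. For $\zeta\in\mathrm{IS}$, $\mathbb P'_\zeta$ is the set of $X\subseteq\mathcal D^\zeta$ with: (P1) closed nonempty; (P2) each $D_{Xz}(i)$ ($i\in\zeta$) perfect; (P3) for $i\in\zeta$ and open $G\subseteq\mathcal D$, $\{x\restriction_{<i}:x\in X,x(i)\in G\}$ open in $X\restriction_{<i}$; (P4) if $\xi,\eta\in\mathrm{IS}$, $\xi\cup\eta\subseteq\zeta$, $x\in X\restriction\xi$, $y\in X\restriction\eta$, $x\restriction(\xi\cap\eta)=y\restriction(\xi\cap\eta)$,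 then $x\cup y\in X\restriction(\xi\cup\eta)$. For $A\subseteq\mathcal D$ with at least two points, $l$ = length of the longest common finite initial segment of elements of $A$, $\mathrm{Spl}(A,e)=\{a\in A:a(l)=e\}$; $\mathrm{Spl}(X,i,e)=\{x\in X:x(i)\in\mathrm{Spl}(D_{X,x\restriction_{<i}}(i),e)\}$. A $\zeta$-admissible function is $\Phi:\omega\to\zeta$ taking each value infinitely often; $X_\Phi[\Lambda]=X$, $X_\Phi[u^\frown e]=\mathrm{Spl}(X_\Phi[u],\Phi(m),e)$ for $u\in2^m$, $X_\Phi[a]=\bigcap_mX_\Phi[a\restriction m]$. $X$ is shrinkable if all $X_\Phi[a]$ are singletons; $\mathbb P_\zeta$ = shrinkable members of $\mathbb P'_\zeta$. -}

module Defs where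

open import Data.Nat using (ℕ; _<_; _≤_)
open import Data.Bool using (Bool)
open import Data.List using (List)
open import Data.List.Relation.Unary.All using (All)
open import Data.Product using (Σ; ∃; ∃₂; _×_; _,_)
open import Data.Sum using (_⊎_)
open import Relation.Binary.PropositionalEquality using (_≡_; _≢_)
open import Relation.Nullary using (¬_)

D : Set
D = ℕ → Bool

AgreeBelow : ℕ → D → D → Set
AgreeBelow n a b = ∀ m → m < n → a m ≡ b m

EqD : D → D → Set
EqD a b = ∀ m → a m ≡ b m

ClosedD : (D → Set) → Set
ClosedD A = ∀ a → (∀ n → ∃ λ b → A b × AgreeBelow n a b) → A a

PerfectD : (D → Set) → Set
PerfectD A = ClosedD A × (∀ a → A a → ∀ n → ∃ λ b → A b × AgreeBelow n a b × ¬ EqD a b)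

OpenD : (D → Set) → Set
OpenD G = ∀ a → G a → ∃ λ n → ∀ b → AgreeBelow n a b → G b

Spl : (D → Set) → Bool → D → Set
Spl A e a = A a × (∃ λ l → (∀ b c → A b → A c → AgreeBelow l b c)
                        × (∃₂ λ b c → A b × A c × b l ≢ c l)
                        × a l ≡ e)

module Setup (I : Set) (_≺_ : I → I → Set) where

  -- a point of D^I; a point of D^ξ is represented by any x : I → D,
  -- two representatives being identified when they agree on ξ.
  Pt : Set
  Pt = I → D

  SubI : Set₁
  SubI = I → Set

  _≈[_]_ : Pt → SubI → Pt → Set
  x ≈[ ξ ] y = ∀ i → ξ i → EqD (x i) (y i)

  _⊆I_ : SubI → SubI → Set
  ξ ⊆I η = ∀ i → ξ i → η i

  _∩I_ : SubI → SubI → SubI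
  (ξ ∩I η) i = ξ i × η i

  _∪I_ : SubI → SubI → SubI
  (ξ ∪I η) i = ξ i ⊎ η i

  Initial : SubI → Set
  Initial ξ = ∀ i j → j ≺ i → ξ i → ξ j

  below : I → SubI
  below i j = j ≺ i

  -- X ⊆ D^ξ : a predicate on Pt depending only on the coordinates in ξ
  OnCoords : SubI → (Pt → Set) → Set
  OnCoords ξ X = ∀ x y → x ≈[ ξ ] y → X x → X y

  Restr : SubI → (Pt → Set) → Pt → Set
  Restr ξ X y = ∃ λ x → X x × x ≈[ ξ ] y

  Preim : SubI → (Pt → Set) → Pt → Set
  Preim ξ Y y = ∃ λ x → Y x × y ≈[ ξ ] x

  Near : List I → ℕ → Pt → Pt → Set
  Near F n x y = All (λ i → AgreeBelow n (x i) (y i)) F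

  Closed : SubI → (Pt → Set) → Set
  Closed ξ X = ∀ x → (∀ F → All ξ F → ∀ n → ∃ λ y → X y × Near F n x y) → X x

  OpenIn : SubI → (Pt → Set) → (Pt → Set) → Set
  OpenIn ξ S U = ∀ z → U z → ∃₂ λ F n → All ξ F × (∀ w → S w → Near F n z w → U w)

  Sec : (Pt → Set) → I → Pt → D → Set
  Sec X i z a = ∃ λ x → X x × x ≈[ below i ] z × EqD (x i) a

  SplX : (Pt → Set) → I → Bool → Pt → Set
  SplX X i e x = X x × Spl (Sec X i x) e (x i)

  P' : SubI → (Pt → Set) → Set₁
  P' ζ X =
      OnCoords ζ X
    × (Closed ζ X × ∃ X)
    × (∀ i → ζ i → ∀ z → Restr (below i) X z → PerfectD (Sec X i z))
    × (∀ i → ζ i → (G : D → Set) → OpenD G →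
         OpenIn (below i) (Restr (below i) X)
                (λ z → ∃ λ x → X x × x ≈[ below i ] z × G (x i)))
    -- (P4): x ∪ y ∈ X ↾ (ξ ∪ η)
    × (∀ ξ η → Initial ξ → Initial η → (ξ ∪I η) ⊆I ζ →
         ∀ x y → Restr ξ X x → Restr η X y → x ≈[ ξ ∩I η ] y →
         ∃ λ v → X v × v ≈[ ξ ] x × v ≈[ η ] y)

  Admissible : SubI → (ℕ → I) → Set
  Admissible ζ Φ = (∀ m → ζ (Φ m)) × (∀ i → ζ i → ∀ n → ∃ λ m → n ≤ m × Φ m ≡ i)

  Fus : (Pt → Set) → (ℕ → I) → (ℕ → Bool) → ℕ → Pt → Set
  Fus X Φ a ℕ.zero = X
  Fus X Φ a (ℕ.suc m) = SplX (Fus X Φ a m) (Φ m) (a m)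

  Shrinkable : SubI → (Pt → Set) → Set
  Shrinkable ζ X = ∀ Φ → Admissible ζ Φ → ∀ a →
    ∃ λ x → (∀ m → Fus X Φ a m x) × (∀ y → (∀ m → Fus X Φ a m y) → y ≈[ ζ ] x)

  P : SubI → (Pt → Set) → Set₁
  P ζ X = P' ζ X × Shrinkable ζ X

-- Z = X ∩ (Y ↾⁻¹ ζ) lies in ℙ′_ζ because its section at a coordinate of ξ is the section of Y there, while
-- at a coordinate outside ξ it is the section of X (amalgamate in X with a point of Z); amalgams in Z are
-- obtained by amalgamating, in X, an amalgam taken in Y with one taken in X.
--
-- Spl preserves ℙ′_ζ (the splitting level of a section is locally constant,
-- by P3 and compactness), so the stages Z_Φ[a↾m] are closed, nonempty and decreasing, and by compactness of
-- D^I their intersection is nonempty. Two of its points agree on ξ, since restricted to ξ the stages are those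
-- of the fusion of Y along the subsequence of Φ that lands in ξ; and they agree on ζ, since over the fibre of
-- x↾ξ the stages coincide with those of a fusion of X along Φ whose bits are chosen so that x survives.
-- Compactness is proved by fixing the digits of the limit point one at a time along an enumeration of I × ℕ,
-- using excluded middle.

module Submission where

open import Defs
open import Data.Nat using (ℕ; zero; suc; _+_; _⊔_; _<_; _≤_; z≤n; s≤s)
open import Data.Nat.Properties
open import Data.Bool using (Bool; true; false; not)
open import Data.Bool.Properties using (¬-not) renaming (_≟_ to _≟ᴮ_)
open import Data.List using (List; []; _∷_; _++_)
open import Data.List.Relation.Unary.All using (All; []; _∷_)
open import Data.List.Relation.Unary.All.Properties using (++⁺; ++⁻ˡ; ++⁻ʳ)
open import Data.List.Relation.Unary.Any using (here; there)
open import Data.List.Membership.Propositional using (_∈_)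
import Data.List.Relation.Unary.All as All
open import Data.Product using (∃; ∃₂; _×_; _,_; proj₁; proj₂; swap)
open import Data.Sum using (_⊎_; inj₁; inj₂)
open import Data.Empty using (⊥; ⊥-elim)
open import Data.Unit using (tt)
open import Function.Definitions using (Injective)
open import Relation.Binary.PropositionalEquality
  using (_≡_; _≢_; ≢-sym; refl; sym; trans; cong; subst; subst₂; module ≡-Reasoning)
open import Relation.Binary.Definitions using (tri<; tri≈; tri>)
open import Relation.Nullary using (¬_; Dec; does; yes; no)
open import Relation.Unary using (U; _∩_; _⊆′_; _≐′_)
open import Relation.Binary.Structures using (IsStrictPartialOrder)
open import Axiom.ExcludedMiddle using (ExcludedMiddle)
open import Axiom.DoubleNegationElimination using (em⇒dne)
open import Level using (0ℓ)

triangle : ℕ → ℕ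
triangle zero = 0
triangle (suc s) = suc (s + triangle s)

-- unpair enumerates ℕ × ℕ along the diagonals c + d = 0, 1, 2, …, each from (c + d , 0) to (0 , c + d).
next : ℕ × ℕ → ℕ × ℕ
next (zero , d) = suc d , 0
next (suc c , d) = c , suc d

unpair : ℕ → ℕ × ℕ
unpair zero = 0 , 0
unpair (suc p) = next (unpair p)

pair : ℕ → ℕ → ℕ
pair c d = triangle (c + d) + d

unpair-+ : ∀ k c d p → unpair p ≡ (k + c , d) → unpair (k + p) ≡ (c , k + d)
unpair-+ zero c d p eq = eq
unpair-+ (suc k) c d p eq =
  subst₂ (λ q e → unpair q ≡ (c , e)) (+-suc k p) (+-suc k d)
         (unpair-+ k c (suc d) (suc p) (cong next eq))

unpair-triangle : ∀ s → unpair (triangle s) ≡ (s , 0)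
unpair-triangle zero = refl
unpair-triangle (suc s) = cong next (trans (unpair-+ s 0 0 (triangle s) start) (cong (0 ,_) (+-identityʳ s)))
  where
  start : unpair (triangle s) ≡ (s + 0 , 0)
  start = trans (unpair-triangle s) (cong (_, 0) (sym (+-identityʳ s)))

unpair-pair : ∀ c d → unpair (pair c d) ≡ (c , d)
unpair-pair c d = begin
  unpair (triangle (c + d) + d) ≡⟨ cong unpair (+-comm (triangle (c + d)) d) ⟩
  unpair (d + triangle (c + d)) ≡⟨ unpair-+ d c 0 _ diagonal ⟩
  (c , d + 0)                   ≡⟨ cong (c ,_) (+-identityʳ d) ⟩
  (c , d)                       ∎
  where
  open ≡-Reasoning
  diagonal : unpair (triangle (c + d)) ≡ (d + c , 0)
  diagonal = trans (unpair-triangle (c + d)) (cong (_, 0) (+-comm c d))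

unpair-bounded : ∀ p → proj₁ (unpair p) + proj₂ (unpair p) ≤ p
unpair-bounded zero = z≤n
unpair-bounded (suc p) with unpair p | unpair-bounded p
... | zero , d | c+d≤p = s≤s (subst (_≤ p) (sym (+-identityʳ d)) c+d≤p)
... | suc c , d | c+d≤p = subst (_≤ suc p) (sym (+-suc c d)) (m≤n⇒m≤1+n c+d≤p)

bounded-below : (h : ℕ → ℕ) (n : ℕ) → ∃ λ P → ∀ d → d < n → h d < P
bounded-below h zero = 0 , λ _ ()
bounded-below h (suc n) with bounded-below h n
... | P , h<P = P ⊔ suc (h n) , bound
  where
  bound : ∀ d → d < suc n → h d < P ⊔ suc (h n)
  bound d d<1+n with m<1+n⇒m<n∨m≡n d<1+n
  ... | inj₁ d<n = <-≤-trans (h<P d d<n) (m≤m⊔n P _)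
  ... | inj₂ refl = <-≤-trans (n<1+n (h n)) (m≤n⊔m P _)

bounded-below-All : ∀ {A : Set} (h : A → ℕ → ℕ) (F : List A) (n : ℕ) →
                    ∃ λ P → All (λ j → ∀ d → d < n → h j d < P) F
bounded-below-All h [] n = 0 , []
bounded-below-All h (j ∷ F) n with bounded-below (h j) n | bounded-below-All h F n
... | P , h<P | Q , hF<Q = P ⊔ Q , weaken (m≤m⊔n P Q) h<P ∷ All.map (weaken (m≤n⊔m P Q)) hF<Q
  where
  weaken : ∀ {R S} {g : ℕ → ℕ} → R ≤ S → (∀ d → d < n → g d < R) → ∀ d → d < n → g d < S
  weaken R≤S g<R d d<n = <-≤-trans (g<R d d<n) R≤S

module Enumeration {Q : ℕ → Set} (Q? : ∀ m → Dec (Q m)) (Q-unbounded : ∀ n → ∃ λ m → n ≤ m × Q m) where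

  count : ℕ → ℕ
  count zero = 0
  count (suc m) with Q? m
  ... | yes _ = suc (count m)
  ... | no _ = count m

  count-suc : ∀ {m} → Q m → count (suc m) ≡ suc (count m)
  count-suc {m} Qm with Q? m
  ... | yes _ = refl
  ... | no ¬Qm = ⊥-elim (¬Qm Qm)

  count-mono : ∀ {m k} → m ≤ k → count m ≤ count k
  count-mono {k = zero} z≤n = ≤-refl
  count-mono {m} {suc k} m≤1+k with m≤n⇒m<n∨m≡n m≤1+k
  ... | inj₂ refl = ≤-refl
  ... | inj₁ m<1+k with Q? k
  ...   | yes _ = m≤n⇒m≤1+n (count-mono (≤-pred m<1+k))
  ...   | no _ = count-mono (≤-pred m<1+k)

  count-unbounded : ∀ n → ∃ λ M → n ≤ count M
  count-unbounded zero = 0 , z≤n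
  count-unbounded (suc n) with count-unbounded n
  ... | M , n≤count with Q-unbounded M
  ... | m , M≤m , Qm = suc m , subst (suc n ≤_) (sym (count-suc Qm)) (s≤s (≤-trans n≤count (count-mono M≤m)))

  count-reaches : ∀ M k → k < count M → ∃ λ m → Q m × count m ≡ k
  count-reaches (suc M) k k<count with Q? M
  ... | no _ = count-reaches M k k<count
  ... | yes QM with m<1+n⇒m<n∨m≡n k<count
  ...   | inj₁ k<count′ = count-reaches M k k<count′
  ...   | inj₂ refl = M , QM , refl

  count-injective : ∀ {m m′} → Q m → Q m′ → count m ≡ count m′ → m ≡ m′
  count-injective {m} {m′} Qm Qm′ eq with <-cmp m m′
  ... | tri≈ _ m≡m′ _ = m≡m′
  ... | tri< m<m′ _ _ = ⊥-elim (<-irrefl eq (subst (_≤ count m′) (count-suc Qm) (count-mono m<m′)))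
  ... | tri> _ _ m′<m = ⊥-elim (<-irrefl (sym eq) (subst (_≤ count m) (count-suc Qm′) (count-mono m′<m)))

  count-surjective : ∀ k → ∃ λ m → Q m × count m ≡ k
  count-surjective k = let M , 1+k≤count = count-unbounded (suc k) in count-reaches M k 1+k≤count

  nth : ℕ → ℕ
  nth k = proj₁ (count-surjective k)

  Q-nth : ∀ k → Q (nth k)
  Q-nth k = proj₁ (proj₂ (count-surjective k))

  nth-count : ∀ {m} → Q m → nth (count m) ≡ m
  nth-count Qm = count-injective (Q-nth _) Qm (proj₂ (proj₂ (count-surjective _)))

EqD-sym : ∀ {a b} → EqD a b → EqD b a
EqD-sym a=b m = sym (a=b m)

EqD-trans : ∀ {a b c} → EqD a b → EqD b c → EqD a c
EqD-trans a=b b=c m = trans (a=b m) (b=c m)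

AgreeBelow-mono : ∀ {m n a b} → m ≤ n → AgreeBelow n a b → AgreeBelow m a b
AgreeBelow-mono m≤n a=b k k<m = a=b k (<-≤-trans k<m m≤n)

AgreeBelow-sym : ∀ {n a b} → AgreeBelow n a b → AgreeBelow n b a
AgreeBelow-sym a=b k k<n = sym (a=b k k<n)

AgreeBelow-trans : ∀ {n a b c} → AgreeBelow n a b → AgreeBelow n b c → AgreeBelow n a c
AgreeBelow-trans a=b b=c k k<n = trans (a=b k k<n) (b=c k k<n)

OpenD-resp-EqD : ∀ {G} → OpenD G → ∀ {a b} → EqD a b → G a → G b
OpenD-resp-EqD G-open {a} {b} a=b Ga = proj₂ (G-open a Ga) b (λ k _ → a=b k)

ClosedD-resp-≐ : ∀ {A B} → A ≐′ B → ClosedD A → ClosedD B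
ClosedD-resp-≐ (A⊆B , B⊆A) A-closed a approx =
  A⊆B a (A-closed a λ n → let b , Bb , a=b = approx n in b , B⊆A b Bb , a=b)

PerfectD-resp-≐ : ∀ {A B} → A ≐′ B → PerfectD A → PerfectD B
PerfectD-resp-≐ (A⊆B , B⊆A) (A-closed , A-dense) = ClosedD-resp-≐ (A⊆B , B⊆A) A-closed ,
  λ a Ba n → let b , Ab , a=b , a≠b = A-dense a (B⊆A a Ba) n in b , A⊆B b Ab , a=b , a≠b

Agree : (D → Set) → ℕ → Set
Agree A l = ∀ b c → A b → A c → AgreeBelow l b c

Differ : (D → Set) → ℕ → Set
Differ A l = ∃₂ λ b c → A b × A c × b l ≢ c l

Agree-anti : ∀ {A B l} → A ⊆′ B → Agree B l → Agree A l
Agree-anti A⊆B B-agree b c Ab Ac = B-agree b c (A⊆B b Ab) (A⊆B c Ac)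

Differ-mono : ∀ {A B l} → A ⊆′ B → Differ A l → Differ B l
Differ-mono A⊆B (b , c , Ab , Ac , b≠c) = b , c , A⊆B b Ab , A⊆B c Ac , b≠c

SplitsAt : (D → Set) → ℕ → Set
SplitsAt A l = Agree A l × Differ A l

splitting-level-unique : ∀ {A l l′} → SplitsAt A l → SplitsAt A l′ → l ≡ l′
splitting-level-unique {l = l} {l′} (agree , differ) (agree′ , differ′) with <-cmp l l′
... | tri≈ _ l≡l′ _ = l≡l′
... | tri< l<l′ _ _ = let b , c , Ab , Ac , b≠c = differ in ⊥-elim (b≠c (agree′ b c Ab Ac l l<l′))
... | tri> _ _ l′<l = let b , c , Ab , Ac , b≠c = differ′ in ⊥-elim (b≠c (agree b c Ab Ac l′ l′<l))

Spl-intro : ∀ {A e a} l → A a → SplitsAt A l → a l ≡ e → Spl A e a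
Spl-intro l Aa (agree , differ) al≡e = Aa , l , agree , differ , al≡e

SplitsAt-resp-≐ : ∀ {A B l} → A ≐′ B → SplitsAt A l → SplitsAt B l
SplitsAt-resp-≐ (A⊆B , B⊆A) (agree , differ) = Agree-anti B⊆A agree , Differ-mono A⊆B differ

AgreeBelow-open : ∀ n b → OpenD (AgreeBelow n b)
AgreeBelow-open n b a b=a = n , λ a′ a=a′ → AgreeBelow-trans b=a a=a′

OpenD-∩ : ∀ {G H} → OpenD G → OpenD H → OpenD (G ∩ H)
OpenD-∩ G-open H-open a (Ga , Ha) with G-open a Ga | H-open a Ha
... | m , G-near | n , H-near =
  m + n , λ b a=b → G-near b (AgreeBelow-mono (m≤m+n m n) a=b) , H-near b (AgreeBelow-mono (m≤n+m n m) a=b)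

Spl-resp-≐ : ∀ {A B} e {a b} → A ≐′ B → EqD a b → B b → Spl A e a → Spl B e b
Spl-resp-≐ e (A⊆B , B⊆A) a=b Bb (_ , l , agree , differ , al≡e) =
  Bb , l , Agree-anti B⊆A agree , Differ-mono A⊆B differ , trans (sym (a=b l)) al≡e

Spl-bit-unique : ∀ {A e e′ a} → Spl A e a → Spl A e′ a → e ≡ e′
Spl-bit-unique (_ , l , agree , differ , al≡e) (_ , l′ , agree′ , differ′ , al′≡e′)
  with splitting-level-unique (agree , differ) (agree′ , differ′)
... | refl = trans (sym al≡e) al′≡e′

Spl-perfect : ∀ {A} e → PerfectD A → PerfectD (Spl A e)
Spl-perfect {A} e (A-closed , A-dense) = closed , dense
  where
  closed : ClosedD (Spl A e)
  closed a approx with approx 0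
  ... | _ , (_ , l , agree , differ , _) , _ with approx (suc l)
  ... | b , (_ , l′ , agree′ , differ′ , bl′≡e) , a=b with splitting-level-unique (agree , differ) (agree′ , differ′)
  ... | refl = Spl-intro l (A-closed a λ n → let b , (Ab , _) , a=b = approx n in b , Ab , a=b)
                         (agree , differ) (trans (a=b l (n<1+n l)) bl′≡e)
  dense : ∀ a → Spl A e a → ∀ n → ∃ λ b → Spl A e b × AgreeBelow n a b × ¬ EqD a b
  dense a (Aa , l , agree , differ , al≡e) n with A-dense a Aa (n + suc l)
  ... | b , Ab , a=b , a≠b =
    b , Spl-intro l Ab (agree , differ) (trans (sym (a=b l (m+n≤o⇒n≤o n ≤-refl))) al≡e) ,
    AgreeBelow-mono (m≤m+n n (suc l)) a=b , a≠b

module _ (em : ExcludedMiddle 0ℓ) where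

  private
    dne = em⇒dne em

  ¬EqD⇒≢ : ∀ {a b} → ¬ EqD a b → ∃ λ m → a m ≢ b m
  ¬EqD⇒≢ a≠b = dne λ ∄m → a≠b λ m → dne λ am≠bm → ∄m (m , am≠bm)

  least-witness : (Q : ℕ → Set) → ∀ {m} → Q m → ∃ λ l → Q l × (∀ k → k < l → ¬ Q k)
  least-witness Q {m} Qm = below m ≤-refl Qm
    where
    below : ∀ n {m} → m ≤ n → Q m → ∃ λ l → Q l × (∀ k → k < l → ¬ Q k)
    below zero z≤n Q0 = 0 , Q0 , λ _ ()
    below (suc n) {m} m≤1+n Qm with em {∃ λ k → k < m × Q k}
    ... | yes (k , k<m , Qk) = below n (≤-pred (≤-trans k<m m≤1+n)) Qk
    ... | no ∄k = m , Qm , λ k k<m Qk → ∄k (k , k<m , Qk)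

  splitting-level : ∀ {A a} → PerfectD A → A a → ∃ (SplitsAt A)
  splitting-level {A} {a} (_ , A-dense) Aa with A-dense a Aa 0
  ... | b , Ab , _ , a≠b with ¬EqD⇒≢ a≠b
  ... | m , am≠bm with least-witness (Differ A) (a , b , Aa , Ab , am≠bm)
  ... | l , differ , below-l-agree = l , agree , differ
    where
    agree : Agree A l
    agree b c Ab Ac k k<l = dne λ bk≠ck → below-l-agree k k<l (b , c , Ab , Ac , bk≠ck)

  Spl-nonempty : ∀ {A a} → PerfectD A → A a → ∀ e → ∃ (Spl A e)
  Spl-nonempty A-perfect Aa e with splitting-level A-perfect Aa
  ... | l , agree , (b , c , Ab , Ac , bl≠cl) with b l ≟ᴮ e
  ... | yes bl≡e = b , Spl-intro l Ab (agree , b , c , Ab , Ac , bl≠cl) bl≡e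
  ... | no bl≠e = c , Spl-intro l Ac (agree , b , c , Ab , Ac , bl≠cl)
                        (trans (¬-not (≢-sym bl≠cl)) (sym (¬-not (≢-sym bl≠e))))

module _ (em : ExcludedMiddle 0ℓ) (I : Set) (_≺_ : I → I → Set)
         (≺-strict : IsStrictPartialOrder _≡_ _≺_)
         (code : I → ℕ) (code-injective : Injective _≡_ _≡_ code) where

  open Setup I _≺_
  open IsStrictPartialOrder ≺-strict using () renaming (trans to ≺-trans)

  private
    dne = em⇒dne em

  PtSet : Set₁
  PtSet = Pt → Set

  ≈-refl : ∀ {ξ x} → x ≈[ ξ ] x
  ≈-refl _ _ _ = refl

  ≈-sym : ∀ {ξ x y} → x ≈[ ξ ] y → y ≈[ ξ ] x
  ≈-sym x≈y i ξi = EqD-sym (x≈y i ξi)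

  ≈-trans : ∀ {ξ x y z} → x ≈[ ξ ] y → y ≈[ ξ ] z → x ≈[ ξ ] z
  ≈-trans x≈y y≈z i ξi = EqD-trans (x≈y i ξi) (y≈z i ξi)

  ≈-mono : ∀ {ξ η x y} → ξ ⊆I η → x ≈[ η ] y → x ≈[ ξ ] y
  ≈-mono ξ⊆η x≈y i ξi = x≈y i (ξ⊆η i ξi)

  Near-mono : ∀ {F m n x y} → m ≤ n → Near F n x y → Near F m x y
  Near-mono m≤n = All.map (AgreeBelow-mono m≤n)

  atMost : I → SubI
  atMost i j = j ≺ i ⊎ j ≡ i

  below⊆atMost : ∀ i → below i ⊆I atMost i
  below⊆atMost i _ = inj₁

  Initial-atMost : ∀ i → Initial (atMost i)
  Initial-atMost i j k k≺j (inj₁ j≺i) = inj₁ (≺-trans k≺j j≺i)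
  Initial-atMost i j k k≺j (inj₂ refl) = inj₁ k≺j

  Initial-∪ : ∀ {ξ η} → Initial ξ → Initial η → Initial (ξ ∪I η)
  Initial-∪ ξ-initial η-initial j k k≺j (inj₁ ξj) = inj₁ (ξ-initial j k k≺j ξj)
  Initial-∪ ξ-initial η-initial j k k≺j (inj₂ ηj) = inj₂ (η-initial j k k≺j ηj)

  Initial-∩ : ∀ {ξ η} → Initial ξ → Initial η → Initial (ξ ∩I η)
  Initial-∩ ξ-initial η-initial j k k≺j (ξj , ηj) = ξ-initial j k k≺j ξj , η-initial j k k≺j ηj

  below-⊆ : ∀ {ζ i} → Initial ζ → ζ i → below i ⊆I ζ
  below-⊆ ζ-initial ζi j j≺i = ζ-initial _ j j≺i ζi

  atMost-⊆ : ∀ {ζ i} → Initial ζ → ζ i → atMost i ⊆I ζ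
  atMost-⊆ ζ-initial ζi j (inj₁ j≺i) = below-⊆ ζ-initial ζi j j≺i
  atMost-⊆ ζ-initial ζi j (inj₂ refl) = ζi

  at-pair : ∀ {R : I → ℕ → Set} j d →
            (∀ j′ → code j′ ≡ proj₁ (unpair (pair (code j) d)) → R j′ (proj₂ (unpair (pair (code j) d)))) →
            R j d
  at-pair {R} j d h = subst (R j) (cong proj₂ j,d) (h j (sym (cong proj₁ j,d)))
    where
    j,d = unpair-pair (code j) d

  DigitIs : ℕ → Bool → PtSet
  DigitIs p b y = ∀ j → code j ≡ proj₁ (unpair p) → y j (proj₂ (unpair p)) ≡ b

  DigitIs-from : ∀ {b} p y j → code j ≡ proj₁ (unpair p) → y j (proj₂ (unpair p)) ≡ b → DigitIs p b y
  DigitIs-from p y j cj yj≡b j′ cj′ with code-injective (trans cj′ (sym cj))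
  ... | refl = yj≡b

  digit-dichotomy : ∀ p y → DigitIs p false y ⊎ DigitIs p true y
  digit-dichotomy p y with em {∃ λ j → code j ≡ proj₁ (unpair p)}
  ... | no ∄j = inj₁ λ j cj → ⊥-elim (∄j (j , cj))
  ... | yes (j , cj) with y j (proj₂ (unpair p)) in yj
  ...   | false = inj₁ (DigitIs-from p y j cj yj)
  ...   | true = inj₂ (DigitIs-from p y j cj yj)

  -- The limit point is built digit by digit: digit p (coordinate and position given by unpair p) is
  -- chosen so that the points still available meet every finite intersection of the C q.
  module Compactness (C : ℕ → PtSet) where

    MeetsAll : PtSet → Set
    MeetsAll B = ∀ K → ∃ λ y → B y × (∀ q → q < K → C q y)

    nextDigit : PtSet → ℕ → Bool
    nextDigit B p = not (does (em {MeetsAll (B ∩ DigitIs p false)}))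

    MeetsAll-refine : ∀ {B} p → MeetsAll B → (d : Dec (MeetsAll (B ∩ DigitIs p false))) →
                      MeetsAll (B ∩ DigitIs p (not (does d)))
    MeetsAll-refine p meets (yes meets-false) = meets-false
    MeetsAll-refine {B} p meets (no ¬meets-false) K =
      dne λ ∄y → ¬meets-false λ K′ → escape ∄y K′ (meets (K + K′))
      where
      escape : ¬ (∃ λ y → (B ∩ DigitIs p true) y × (∀ q → q < K → C q y)) →
               ∀ K′ → (∃ λ y → B y × (∀ q → q < K + K′ → C q y)) →
               ∃ λ y → (B ∩ DigitIs p false) y × (∀ q → q < K′ → C q y)
      escape ∄y K′ (y , By , Cy) with digit-dichotomy p y
      ... | inj₁ y-false = y , (By , y-false) , λ q q<K′ → Cy q (<-≤-trans q<K′ (m≤n+m K′ K))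
      ... | inj₂ y-true = ⊥-elim (∄y (y , (By , y-true) , λ q q<K → Cy q (<-≤-trans q<K (m≤m+n K K′))))

    approx : ℕ → PtSet
    approx zero = U
    approx (suc p) = approx p ∩ DigitIs p (nextDigit (approx p) p)

    approx-meetsAll : MeetsAll U → ∀ p → MeetsAll (approx p)
    approx-meetsAll meets zero = meets
    approx-meetsAll meets (suc p) = MeetsAll-refine p (approx-meetsAll meets p) em

    approx-digit : ∀ P {y} → approx P y → ∀ q → q < P → DigitIs q (nextDigit (approx q) q) y
    approx-digit (suc P) (approxPy , _) q q<1+P with m<1+n⇒m<n∨m≡n q<1+P
    ... | inj₁ q<P = approx-digit P approxPy q q<P
    approx-digit (suc P) (_ , digit) q q<1+P | inj₂ refl = digit

    limit : Pt
    limit j d = nextDigit (approx (pair (code j) d)) (pair (code j) d)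

    approx-near-limit : ∀ F n P → All (λ j → ∀ d → d < n → pair (code j) d < P) F →
                        ∀ {y} → approx P y → Near F n limit y
    approx-near-limit F n P bounds {y} approxPy =
      All.map (λ {j} pair<P d d<n →
                 sym (at-pair {λ j′ d′ → y j′ d′ ≡ limit j d} j d (approx-digit P approxPy _ (pair<P d d<n))))
              bounds

  compactness : ∀ {ζ} (C : ℕ → PtSet) → (∀ q → Closed ζ (C q)) →
                (∀ K → ∃ λ y → ∀ q → q < K → C q y) → ∃ λ x → ∀ q → C q x
  compactness C C-closed fip = limit , λ q → C-closed q limit λ F _ n →
    let P , bounds = bounded-below-All (λ j → pair (code j)) F n
        y , approxPy , Cy = approx-meetsAll (λ K → let y , Cy = fip K in y , tt , Cy) P (suc q)
    in y , Cy q (n<1+n q) , approx-near-limit F n P bounds approxPy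
    where
    open Compactness C

  codedIn : SubI → ℕ → List I
  codedIn η zero = []
  codedIn η (suc K) with em {∃ λ j → code j ≡ K × η j}
  ... | yes (j , _) = j ∷ codedIn η K
  ... | no _ = codedIn η K

  All-codedIn : ∀ η K → All η (codedIn η K)
  All-codedIn η zero = []
  All-codedIn η (suc K) with em {∃ λ j → code j ≡ K × η j}
  ... | yes (j , _ , ηj) = ηj ∷ All-codedIn η K
  ... | no _ = All-codedIn η K

  ∈-codedIn : ∀ {η j} K → η j → code j < K → j ∈ codedIn η K
  ∈-codedIn {η} {j} (suc K) ηj cj<1+K with em {∃ λ j′ → code j′ ≡ K × η j′} | m<1+n⇒m<n∨m≡n cj<1+K
  ... | yes _ | inj₁ cj<K = there (∈-codedIn K ηj cj<K)
  ... | yes (_ , cj′ , _) | inj₂ cj≡K = here (code-injective (trans cj≡K (sym cj′)))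
  ... | no _ | inj₁ cj<K = ∈-codedIn K ηj cj<K
  ... | no ∄j | inj₂ cj≡K = ⊥-elim (∄j (j , cj≡K , ηj))

  limit-in-fiber : ∀ {ζ η C z} → η ⊆I ζ → Closed ζ C →
                   (∀ K → ∃ λ y → C y × Near (codedIn η K) K z y) → ∃ λ x → C x × x ≈[ η ] z
  limit-in-fiber {ζ} {η} {C} {z} η⊆ζ C-closed approach =
    let x , constraints = compactness constraint constraint-closed fip
    in x , constraints 0 , λ j ηj d → at-pair {λ j d → η j → x j d ≡ z j d} j d (constraints (suc (pair (code j) d))) ηj
    where
    Matches : ℕ → PtSet
    Matches q y = ∀ j → code j ≡ proj₁ (unpair q) → η j → y j (proj₂ (unpair q)) ≡ z j (proj₂ (unpair q))

    constraint : ℕ → PtSet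
    constraint zero = C
    constraint (suc q) = Matches q

    constraint-closed : ∀ q → Closed ζ (constraint q)
    constraint-closed zero = C-closed
    constraint-closed (suc q) y approx j cj ηj with approx (j ∷ []) (η⊆ζ j ηj ∷ []) (suc (proj₂ (unpair q)))
    ... | _ , matches , near ∷ [] = trans (near _ (n<1+n _)) (matches j cj ηj)

    fip : ∀ K → ∃ λ y → ∀ q → q < K → constraint q y
    fip K with approach K
    ... | y , Cy , near = y , satisfies
      where
      satisfies : ∀ q → q < K → constraint q y
      satisfies zero _ = Cy
      satisfies (suc q) 1+q<K j cj ηj = sym (All.lookup near (∈-codedIn K ηj cj<K) _ d<K)
        where
        q<K = <-trans (n<1+n q) 1+q<K
        cj<K = ≤-<-trans (subst (_≤ q) (sym cj) (m+n≤o⇒m≤o _ (unpair-bounded q))) q<K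
        d<K = ≤-<-trans (m+n≤o⇒n≤o _ (unpair-bounded q)) q<K

  Near-≈ : ∀ {ξ F n x y y′} → All ξ F → y ≈[ ξ ] y′ → Near F n x y → Near F n x y′
  Near-≈ ξF y≈y′ near = All.zipWith (λ {j} (ξj , x=y) m m<n → trans (x=y m m<n) (y≈y′ j ξj m)) (ξF , near)

  NearbyIn : SubI → PtSet → PtSet → Pt → Set
  NearbyIn ξ W Q z = ∃₂ λ F n → All ξ F × (∀ w → W w → Near F n z w → Q w)

  NearbyIn-∩ : ∀ {ξ W Q R z} → NearbyIn ξ W Q z → NearbyIn ξ W R z → NearbyIn ξ W (Q ∩ R) z
  NearbyIn-∩ (F₁ , n₁ , ξF₁ , Q-near) (F₂ , n₂ , ξF₂ , R-near) =
    F₁ ++ F₂ , n₁ + n₂ , ++⁺ ξF₁ ξF₂ ,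
    λ w Ww near → Q-near w Ww (Near-mono (m≤m+n n₁ n₂) (++⁻ˡ F₁ near)) ,
                  R-near w Ww (Near-mono (m≤n+m n₂ n₁) (++⁻ʳ F₁ near))

  NearbyIn-weaken : ∀ {ξ W W′ Q R z} → W′ ⊆′ W → (∀ w → W′ w → Q w → R w) →
                    NearbyIn ξ W Q z → NearbyIn ξ W′ R z
  NearbyIn-weaken W′⊆W Q⇒R (F , n , ξF , Q-near) =
    F , n , ξF , λ w W′w near → Q⇒R w W′w (Q-near w (W′⊆W w W′w) near)

  Restr-self : ∀ {X x} ξ → X x → Restr ξ X x
  Restr-self ξ Xx = _ , Xx , ≈-refl

  Restr-mono : ∀ {X Y} ξ → X ⊆′ Y → Restr ξ X ⊆′ Restr ξ Y
  Restr-mono ξ X⊆Y z (x , Xx , x≈z) = x , X⊆Y x Xx , x≈z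

  Sec-of : ∀ {X x z} i → X x → x ≈[ below i ] z → Sec X i z (x i)
  Sec-of i Xx x≈z = _ , Xx , x≈z , λ _ → refl

  Sec-resp : ∀ X i {z z′ a a′} → z ≈[ below i ] z′ → EqD a a′ → Sec X i z a → Sec X i z′ a′
  Sec-resp X i z≈z′ a=a′ (x , Xx , x≈z , xi=a) = x , Xx , ≈-trans x≈z z≈z′ , EqD-trans xi=a a=a′

  Sec-≐ : ∀ X i {z z′} → z ≈[ below i ] z′ → Sec X i z ≐′ Sec X i z′
  Sec-≐ X i z≈z′ = (λ _ → Sec-resp X i z≈z′ (λ _ → refl)) , (λ _ → Sec-resp X i (≈-sym z≈z′) (λ _ → refl))

  Spl-Sec : ∀ X i e {z z′ a a′} → z ≈[ below i ] z′ → EqD a a′ → Spl (Sec X i z) e a → Spl (Sec X i z′) e a′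
  Spl-Sec X i e z≈z′ a=a′ Spl-a = Spl-resp-≐ e (Sec-≐ X i z≈z′) a=a′ (Sec-resp X i z≈z′ a=a′ (proj₁ Spl-a)) Spl-a

  SplX-≈atMost : ∀ {S i e v w} → SplX S i e w → S v → v ≈[ atMost i ] w → SplX S i e v
  SplX-≈atMost {S} {i} {e} (_ , Spl-w) Sv v≈w =
    Sv , Spl-Sec S i e (≈-sym (≈-mono (below⊆atMost i) v≈w)) (EqD-sym (v≈w i (inj₂ refl))) Spl-w

  SectionMeets : PtSet → I → (D → Set) → PtSet
  SectionMeets X i G z = ∃ λ x → X x × x ≈[ below i ] z × G (x i)

  SectionMeets-mono : ∀ {S T i G w} → OpenD G → Sec S i w ⊆′ Sec T i w → SectionMeets S i G w → SectionMeets T i G w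
  SectionMeets-mono {i = i} G-open S⊆T (x , Sx , x≈w , Gx) with S⊆T (x i) (Sec-of i Sx x≈w)
  ... | t , Tt , t≈w , ti=xi = t , Tt , t≈w , OpenD-resp-EqD G-open (EqD-sym ti=xi) Gx

  PerfectSectionsAt : PtSet → I → Set
  PerfectSectionsAt X i = ∀ z → Restr (below i) X z → PerfectD (Sec X i z)

  OpenSectionsAt : PtSet → I → Set₁
  OpenSectionsAt X i = (G : D → Set) → OpenD G → OpenIn (below i) (Restr (below i) X) (SectionMeets X i G)

  Amalgamation : SubI → PtSet → Set₁
  Amalgamation ζ X = ∀ ξ η → Initial ξ → Initial η → (ξ ∪I η) ⊆I ζ →
                     ∀ x y → Restr ξ X x → Restr η X y → x ≈[ ξ ∩I η ] y →
                     ∃ λ v → X v × v ≈[ ξ ] x × v ≈[ η ] y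

  module _ {ζ X} (X∈P' : P' ζ X) where

    P'-onCoords : OnCoords ζ X
    P'-onCoords = proj₁ X∈P'

    P'-closed : Closed ζ X
    P'-closed = proj₁ (proj₁ (proj₂ X∈P'))

    P'-nonempty : ∃ X
    P'-nonempty = proj₂ (proj₁ (proj₂ X∈P'))

    P'-perfect : ∀ {i} → ζ i → PerfectSectionsAt X i
    P'-perfect ζi = proj₁ (proj₂ (proj₂ X∈P')) _ ζi

    P'-open : ∀ {i} → ζ i → OpenSectionsAt X i
    P'-open ζi = proj₁ (proj₂ (proj₂ (proj₂ X∈P'))) _ ζi

    P'-amalgamation : Amalgamation ζ X
    P'-amalgamation = proj₂ (proj₂ (proj₂ (proj₂ X∈P')))

  mkP' : ∀ {ζ X} → OnCoords ζ X → Closed ζ X → ∃ X → (∀ i → ζ i → PerfectSectionsAt X i) →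
         (∀ i → ζ i → OpenSectionsAt X i) → Amalgamation ζ X → P' ζ X
  mkP' onCoords closed nonempty perfect open′ amalgamation = onCoords , (closed , nonempty) , perfect , open′ , amalgamation

  module _ {S T : PtSet} {i} (Sec-S≐T : ∀ z → Restr (below i) S z → Sec S i z ≐′ Sec T i z)
           (S⊆T : Restr (below i) S ⊆′ Restr (below i) T) where

    PerfectSectionsAt-transfer : PerfectSectionsAt T i → PerfectSectionsAt S i
    PerfectSectionsAt-transfer T-perfect z Sz =
      PerfectD-resp-≐ (swap (Sec-S≐T z Sz)) (T-perfect z (S⊆T z Sz))

    OpenSectionsAt-transfer : OpenSectionsAt T i → OpenSectionsAt S i
    OpenSectionsAt-transfer T-open G G-open z meets@(x , Sx , x≈z , _) =
      NearbyIn-weaken S⊆T (λ w Sw → SectionMeets-mono G-open (proj₂ (Sec-S≐T w Sw)))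
        (T-open G G-open z (SectionMeets-mono G-open (proj₁ (Sec-S≐T z (x , Sx , x≈z))) meets))

  amalgamate-atMost : ∀ {ζ η S j} → Amalgamation ζ S → Initial ζ → Initial η → η ⊆I ζ → ζ j → ¬ η j →
                      ∀ {t w} → S t → S w → t ≈[ below j ] w → ∃ λ v → S v × v ≈[ atMost j ] t × v ≈[ η ] w
  amalgamate-atMost {j = j} S-amalgamation ζ-initial η-initial η⊆ζ ζj ¬ηj St Sw t≈w =
    S-amalgamation (atMost j) _ (Initial-atMost j) η-initial atMost∪η⊆ζ _ _ (Restr-self _ St) (Restr-self _ Sw) agree
    where
    atMost∪η⊆ζ : (atMost j ∪I _) ⊆I _
    atMost∪η⊆ζ k (inj₁ k≤j) = atMost-⊆ ζ-initial ζj k k≤j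
    atMost∪η⊆ζ k (inj₂ ηk) = η⊆ζ k ηk
    agree : _ ≈[ atMost j ∩I _ ] _
    agree k (inj₁ k≺j , _) = t≈w k k≺j
    agree k (inj₂ refl , ηj) = ⊥-elim (¬ηj ηj)

  module _ {ζ S i} (ζ-initial : Initial ζ) (S∈P' : P' ζ S) (ζi : ζ i) where

    Differ-nearby : ∀ z l → Differ (Sec S i z) l →
                    NearbyIn (below i) (Restr (below i) S) (λ w → Differ (Sec S i w) l) z
    Differ-nearby z l (b , c , Sb , Sc , bl≠cl) =
      NearbyIn-weaken (λ _ Sw → Sw) differ (NearbyIn-∩ (near-to b Sb) (near-to c Sc))
      where
      near-to : ∀ a → Sec S i z a → NearbyIn (below i) (Restr (below i) S) (SectionMeets S i (AgreeBelow (suc l) a)) z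
      near-to a (x , Sx , x≈z , xi=a) =
        P'-open S∈P' ζi _ (AgreeBelow-open (suc l) a) z (x , Sx , x≈z , λ k _ → sym (xi=a k))
      differ : ∀ w → Restr (below i) S w →
               (SectionMeets S i (AgreeBelow (suc l) b) ∩ SectionMeets S i (AgreeBelow (suc l) c)) w →
               Differ (Sec S i w) l
      differ w _ ((x , Sx , x≈w , b=xi) , (y , Sy , y≈w , c=yi)) =
        x i , y i , Sec-of i Sx x≈w , Sec-of i Sy y≈w ,
        λ xil=yil → bl≠cl (trans (b=xi l (n<1+n l)) (trans xil=yil (sym (c=yi l (n<1+n l)))))

    -- If Agree failed near z at every scale, compactness would give a point over z itself escaping it.
    Agree-nearby : ∀ z l b → Sec S i z b → Agree (Sec S i z) l →
                   NearbyIn (below i) (Restr (below i) S) (λ w → Agree (Sec S i w) l) z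
    Agree-nearby z l b Szb agree = dne λ ¬nearby →
      let x , (Sx , xi≠b) , x≈z = limit-in-fiber (below-⊆ ζ-initial ζi) escaped-closed (escapes ¬nearby)
      in xi≠b (agree (x i) b (Sec-of i Sx x≈z) Szb)
      where
      Escaped : PtSet
      Escaped x = S x × ¬ AgreeBelow l (x i) b

      escaped-closed : Closed ζ Escaped
      escaped-closed x approx =
        P'-closed S∈P' x (λ F ζF n → let y , (Sy , _) , near = approx F ζF n in y , Sy , near) ,
        λ xi=b → let y , (_ , yi≠b) , near = approx (i ∷ []) (ζi ∷ []) l
                 in yi≠b (AgreeBelow-trans (AgreeBelow-sym (All.head near)) xi=b)

      escapes : ¬ NearbyIn (below i) (Restr (below i) S) (λ w → Agree (Sec S i w) l) z →
                ∀ K → ∃ λ y → Escaped y × Near (codedIn (below i) K) K z y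
      escapes ¬nearby K = dne λ ∄y → ¬nearby (codedIn (below i) K , K , All-codedIn (below i) K , agree-near ∄y)
        where
        agree-near : ¬ (∃ λ y → Escaped y × Near (codedIn (below i) K) K z y) →
                     ∀ w → Restr (below i) S w → Near (codedIn (below i) K) K z w → Agree (Sec S i w) l
        agree-near ∄y w _ near c c′ Swc Swc′ k k<l = agree-at (c k ≟ᴮ b k) (c′ k ≟ᴮ b k)
          where
          escape : ∀ {c} → Sec S i w c → c k ≢ b k → ⊥
          escape (x , Sx , x≈w , xi=c) ck≠bk =
            ∄y (x , (Sx , λ xi=b → ck≠bk (trans (sym (xi=c k)) (xi=b k k<l))) ,
                Near-≈ (All-codedIn (below i) K) (≈-sym x≈w) near)
          agree-at : Dec (c k ≡ b k) → Dec (c′ k ≡ b k) → c k ≡ c′ k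
          agree-at (yes ck=bk) (yes c′k=bk) = trans ck=bk (sym c′k=bk)
          agree-at (no ck≠bk) _ = ⊥-elim (escape Swc ck≠bk)
          agree-at _ (no c′k≠bk) = ⊥-elim (escape Swc′ c′k≠bk)

    SplitsAt-nearby : ∀ z l → SplitsAt (Sec S i z) l →
                      NearbyIn (below i) (Restr (below i) S) (λ w → SplitsAt (Sec S i w) l) z
    SplitsAt-nearby z l (agree , differ@(b , _ , Szb , _)) =
      NearbyIn-∩ (Agree-nearby z l b Szb agree) (Differ-nearby z l differ)

  module Splitting {ζ S i} (ζ-initial : Initial ζ) (S∈P' : P' ζ S) (ζi : ζ i) (e : Bool) where

    S′ : PtSet
    S′ = SplX S i e

    S′⊆S : S′ ⊆′ S
    S′⊆S _ = proj₁

    SplX-lift : ∀ {η} → Initial η → η ⊆I ζ → ¬ η i → ∀ {w} → S w → ∃ λ v → S′ v × v ≈[ η ] w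
    SplX-lift η-initial η⊆ζ ¬ηi {w} Sw
      with Spl-nonempty em (P'-perfect S∈P' ζi w (Restr-self _ Sw)) (Sec-of i Sw ≈-refl) e
    ... | a , Spl-a with proj₁ Spl-a
    ... | t , St , t≈w , ti=a
      with amalgamate-atMost (P'-amalgamation S∈P') ζ-initial η-initial η⊆ζ ζi ¬ηi St Sw t≈w
    ... | v , Sv , v≈t , v≈w =
      v , SplX-≈atMost (St , Spl-Sec S i e (≈-sym t≈w) (EqD-sym ti=a) Spl-a) Sv v≈t , v≈w

    onCoords : OnCoords ζ S′
    onCoords x y x≈y S′x =
      SplX-≈atMost S′x (P'-onCoords S∈P' x y x≈y (proj₁ S′x)) (≈-sym (≈-mono (atMost-⊆ ζ-initial ζi) x≈y))

    nonempty : ∃ S′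
    nonempty = let w , Sw = P'-nonempty S∈P' ; v , S′v , _ = SplX-lift {λ _ → ⊥} (λ _ _ _ ()) (λ _ ()) (λ ()) Sw
               in v , S′v

    -- The splitting level of the section is constant near x, so the digit there is read off a nearby point of S′.
    limit-in-S′ : ∀ x → S x → (∀ F → All ζ F → ∀ n → ∃ λ y → S′ y × Near F n x y) → S′ x
    limit-in-S′ x Sx approx with splitting-level em (P'-perfect S∈P' ζi x (Restr-self _ Sx)) (Sec-of i Sx ≈-refl)
    ... | l , splits with SplitsAt-nearby ζ-initial S∈P' ζi x l splits
    ... | F , n , belowF , splits-nearby
      with approx (i ∷ F) (ζi ∷ All.map (λ {j} → below-⊆ ζ-initial ζi j) belowF) (n + suc l)
    ... | y , (Sy , (_ , l′ , agree′ , differ′ , yil′=e)) , xi=yi ∷ near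
      with splitting-level-unique (splits-nearby y (Restr-self _ Sy) (Near-mono (m≤m+n n (suc l)) near)) (agree′ , differ′)
    ... | refl = Sx , Spl-intro l (Sec-of i Sx ≈-refl) splits (trans (xi=yi l (m+n≤o⇒n≤o n ≤-refl)) yil′=e)

    closed : Closed ζ S′
    closed x approx =
      limit-in-S′ x (P'-closed S∈P' x λ F ζF n → let y , S′y , near = approx F ζF n in y , proj₁ S′y , near) approx

    -- Membership in S′ depends only on the coordinates ≤ i: if i ≺ j it is inherited from x, otherwise it is
    -- arranged by SplX-lift without moving the coordinates ≤ j.
    Sec-other : ∀ {j} → ζ j → j ≢ i → ∀ z → Restr (below j) S′ z → Sec S′ j z ≐′ Sec S j z
    Sec-other {j} ζj j≢i z (x , S′x , x≈z) = (λ _ → forget) , λ _ → lift em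
      where
      forget : ∀ {a} → Sec S′ j z a → Sec S j z a
      forget (w , S′w , w≈z , wj=a) = w , proj₁ S′w , w≈z , wj=a
      lift : ∀ {a} → Dec (i ≺ j) → Sec S j z a → Sec S′ j z a
      lift (yes i≺j) (w , Sw , w≈z , wj=a) =
        w , SplX-≈atMost S′x Sw (≈-mono atMost-i⊆below-j (≈-trans w≈z (≈-sym x≈z))) , w≈z , wj=a
        where
        atMost-i⊆below-j : atMost i ⊆I below j
        atMost-i⊆below-j k (inj₁ k≺i) = ≺-trans k≺i i≺j
        atMost-i⊆below-j k (inj₂ refl) = i≺j
      lift (no i⊀j) (w , Sw , w≈z , wj=a) =
        let v , S′v , v≈w = SplX-lift (Initial-atMost j) (atMost-⊆ ζ-initial ζj) i∉atMost-j Sw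
        in v , S′v , ≈-trans (≈-mono (below⊆atMost j) v≈w) w≈z , EqD-trans (v≈w j (inj₂ refl)) wj=a
        where
        i∉atMost-j : ¬ atMost j i
        i∉atMost-j (inj₁ i≺j) = i⊀j i≺j
        i∉atMost-j (inj₂ i≡j) = j≢i (sym i≡j)

    Sec-same : ∀ z → Sec S′ i z ≐′ Spl (Sec S i z) e
    Sec-same z = (λ _ (w , (_ , Spl-w) , w≈z , wi=a) → Spl-Sec S i e w≈z wi=a Spl-w) , λ _ → lift
      where
      lift : ∀ {a} → Spl (Sec S i z) e a → Sec S′ i z a
      lift Spl-a with proj₁ Spl-a
      ... | t , St , t≈z , ti=a = t , (St , Spl-Sec S i e (≈-sym t≈z) (EqD-sym ti=a) Spl-a) , t≈z , ti=a

    perfect : ∀ j → ζ j → PerfectSectionsAt S′ j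
    perfect j ζj with em {j ≡ i}
    ... | yes refl = λ z S′z →
      PerfectD-resp-≐ (swap (Sec-same z)) (Spl-perfect e (P'-perfect S∈P' ζi z (Restr-mono _ S′⊆S z S′z)))
    ... | no j≢i = PerfectSectionsAt-transfer (Sec-other ζj j≢i) (Restr-mono _ S′⊆S) (P'-perfect S∈P' ζj)

    open-same : OpenSectionsAt S′ i
    open-same G G-open z (x , (Sx , (_ , l , agree , differ , xil=e)) , x≈z , Gx) =
      NearbyIn-weaken (Restr-mono _ S′⊆S) meets-S′
        (NearbyIn-∩ (P'-open S∈P' ζi (G ∩ AgreeBelow (suc l) (x i)) (OpenD-∩ G-open (AgreeBelow-open (suc l) (x i)))
                                z (x , Sx , x≈z , Gx , λ _ _ → refl))
                    (SplitsAt-nearby ζ-initial S∈P' ζi z l (SplitsAt-resp-≐ (Sec-≐ S i x≈z) (agree , differ))))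
      where
      meets-S′ : ∀ w → Restr (below i) S′ w →
                 (SectionMeets S i (G ∩ AgreeBelow (suc l) (x i)) ∩ (λ w → SplitsAt (Sec S i w) l)) w →
                 SectionMeets S′ i G w
      meets-S′ w _ ((t , St , t≈w , Gt , xi=ti) , splits-w) =
        t , (St , Spl-intro l (Sec-of i St ≈-refl) (SplitsAt-resp-≐ (Sec-≐ S i (≈-sym t≈w)) splits-w)
                                (trans (sym (xi=ti l (n<1+n l))) xil=e)) ,
        t≈w , Gt

    open′ : ∀ j → ζ j → OpenSectionsAt S′ j
    open′ j ζj with em {j ≡ i}
    ... | yes refl = open-same
    ... | no j≢i = OpenSectionsAt-transfer (Sec-other ζj j≢i) (Restr-mono _ S′⊆S) (P'-open S∈P' ζj)

    -- The amalgam in S agrees with x₀ or y₀ up to i when i ∈ ξ ∪ η, and can be lifted into S′ otherwise.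
    amalgamation : Amalgamation ζ S′
    amalgamation ξ η ξ-initial η-initial ξ∪η⊆ζ x y (x₀ , S′x₀ , x₀≈x) (y₀ , S′y₀ , y₀≈y) x≈y
      with P'-amalgamation S∈P' ξ η ξ-initial η-initial ξ∪η⊆ζ x y
             (x₀ , proj₁ S′x₀ , x₀≈x) (y₀ , proj₁ S′y₀ , y₀≈y) x≈y
         | em {(ξ ∪I η) i}
    ... | v , Sv , v≈x , v≈y | yes (inj₁ ξi) =
      v , SplX-≈atMost S′x₀ Sv (≈-mono (atMost-⊆ ξ-initial ξi) (≈-trans v≈x (≈-sym x₀≈x))) , v≈x , v≈y
    ... | v , Sv , v≈x , v≈y | yes (inj₂ ηi) =
      v , SplX-≈atMost S′y₀ Sv (≈-mono (atMost-⊆ η-initial ηi) (≈-trans v≈y (≈-sym y₀≈y))) , v≈x , v≈y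
    ... | v , Sv , v≈x , v≈y | no i∉ξ∪η =
      let v′ , S′v′ , v′≈v = SplX-lift (Initial-∪ ξ-initial η-initial) ξ∪η⊆ζ i∉ξ∪η Sv
      in v′ , S′v′ , ≈-trans (≈-mono (λ _ → inj₁) v′≈v) v≈x , ≈-trans (≈-mono (λ _ → inj₂) v′≈v) v≈y

    SplX-P' : P' ζ S′
    SplX-P' = mkP' onCoords closed nonempty perfect open′ amalgamation

  open Splitting using (SplX-lift; SplX-P')

  Fus-P' : ∀ {ζ X Φ} → Initial ζ → P' ζ X → (∀ m → ζ (Φ m)) → ∀ a m → P' ζ (Fus X Φ a m)
  Fus-P' ζ-initial X∈P' ζΦ a zero = X∈P'
  Fus-P' ζ-initial X∈P' ζΦ a (suc m) = SplX-P' ζ-initial (Fus-P' ζ-initial X∈P' ζΦ a m) (ζΦ m) (a m)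

  module Restriction {ξ ζ X Y} (ξ-initial : Initial ξ) (ζ-initial : Initial ζ) (ξ⊆ζ : ξ ⊆I ζ)
                     (X∈P' : P' ζ X) (Y∈P' : P' ξ Y) (Y⊆X↾ξ : Y ⊆′ Restr ξ X) where

    Z : PtSet
    Z = X ∩ Preim ξ Y

    Z⊆X : Z ⊆′ X
    Z⊆X _ = proj₁

    Z⊆Y : Z ⊆′ Y
    Z⊆Y x (_ , v , Yv , x≈v) = P'-onCoords Y∈P' v x (≈-sym x≈v) Yv

    Y⊆Z↾ξ : Y ⊆′ Restr ξ Z
    Y⊆Z↾ξ y Yy = let x , Xx , x≈y = Y⊆X↾ξ y Yy in x , (Xx , y , Yy , x≈y) , x≈y

    onCoords : OnCoords ζ Z
    onCoords x y x≈y (Xx , v , Yv , x≈v) =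
      P'-onCoords X∈P' x y x≈y Xx , v , Yv , ≈-trans (≈-sym (≈-mono ξ⊆ζ x≈y)) x≈v

    closed : Closed ζ Z
    closed x approx =
      P'-closed X∈P' x (λ F ζF n → let y , Zy , near = approx F ζF n in y , Z⊆X y Zy , near) ,
      x , P'-closed Y∈P' x (λ F ξF n → let y , Zy , near = approx F (All.map (λ {j} → ξ⊆ζ j) ξF) n
                                       in y , Z⊆Y y Zy , near) , ≈-refl

    nonempty : ∃ Z
    nonempty = let y , Yy = P'-nonempty Y∈P' ; z , Zz , _ = Y⊆Z↾ξ y Yy in z , Zz

    Sec-inside : ∀ {j} → ξ j → ∀ z → Sec Z j z ≐′ Sec Y j z
    Sec-inside {j} ξj z = (λ _ (x , Zx , x≈z , xj=a) → x , Z⊆Y x Zx , x≈z , xj=a) , λ _ → lift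
      where
      lift : ∀ {a} → Sec Y j z a → Sec Z j z a
      lift (v , Yv , v≈z , vj=a) = let t , Zt , t≈v = Y⊆Z↾ξ v Yv in
        t , Zt , ≈-trans (≈-mono (below-⊆ ξ-initial ξj) t≈v) v≈z , EqD-trans (t≈v j ξj) vj=a

    Sec-outside : ∀ {j} → ζ j → ¬ ξ j → ∀ z → Restr (below j) Z z → Sec Z j z ≐′ Sec X j z
    Sec-outside {j} ζj ¬ξj z (w , (Xw , u , Yu , w≈u) , w≈z) =
      (λ _ (x , Zx , x≈z , xj=a) → x , Z⊆X x Zx , x≈z , xj=a) , λ _ → lift
      where
      lift : ∀ {a} → Sec X j z a → Sec Z j z a
      lift (t , Xt , t≈z , tj=a)
        with amalgamate-atMost (P'-amalgamation X∈P') ζ-initial ξ-initial ξ⊆ζ ζj ¬ξj Xt Xw (≈-trans t≈z (≈-sym w≈z))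
      ... | v , Xv , v≈t , v≈w =
        v , (Xv , u , Yu , ≈-trans v≈w w≈u) ,
        ≈-trans (≈-mono (below⊆atMost j) v≈t) t≈z , EqD-trans (v≈t j (inj₂ refl)) tj=a

    perfect : ∀ j → ζ j → PerfectSectionsAt Z j
    perfect j ζj with em {ξ j}
    ... | yes ξj = PerfectSectionsAt-transfer (λ z _ → Sec-inside ξj z) (Restr-mono _ Z⊆Y) (P'-perfect Y∈P' ξj)
    ... | no ¬ξj = PerfectSectionsAt-transfer (Sec-outside ζj ¬ξj) (Restr-mono _ Z⊆X) (P'-perfect X∈P' ζj)

    open′ : ∀ j → ζ j → OpenSectionsAt Z j
    open′ j ζj with em {ξ j}
    ... | yes ξj = OpenSectionsAt-transfer (λ z _ → Sec-inside ξj z) (Restr-mono _ Z⊆Y) (P'-open Y∈P' ξj)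
    ... | no ¬ξj = OpenSectionsAt-transfer (Sec-outside ζj ¬ξj) (Restr-mono _ Z⊆X) (P'-open X∈P' ζj)

    -- A Y-amalgam u over ξ and an X-amalgam v are themselves amalgamated in X over (ξ′ ∪ η′) and ξ.
    glue : ∀ {ξ′ η′ x y u v} → Initial ξ′ → Initial η′ → (ξ′ ∪I η′) ⊆I ζ →
           Y u → u ≈[ ξ′ ∩I ξ ] x → u ≈[ η′ ∩I ξ ] y → X v → v ≈[ ξ′ ] x → v ≈[ η′ ] y →
           ∃ λ w → Z w × w ≈[ ξ′ ] x × w ≈[ η′ ] y
    glue {ξ′} {η′} {u = u} {v} ξ′-initial η′-initial ξ′∪η′⊆ζ Yu u≈x u≈y Xv v≈x v≈y with Y⊆X↾ξ u Yu
    ... | t , Xt , t≈u =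
      let w , Xw , w≈v , w≈t = P'-amalgamation X∈P' (ξ′ ∪I η′) ξ (Initial-∪ ξ′-initial η′-initial) ξ-initial
                                 ξ′∪η′∪ξ⊆ζ v t (Restr-self _ Xv) (Restr-self _ Xt) v≈t
      in w , (Xw , u , Yu , ≈-trans w≈t t≈u) ,
         ≈-trans (≈-mono (λ _ → inj₁) w≈v) v≈x , ≈-trans (≈-mono (λ _ → inj₂) w≈v) v≈y
      where
      ξ′∪η′∪ξ⊆ζ : ((ξ′ ∪I η′) ∪I ξ) ⊆I ζ
      ξ′∪η′∪ξ⊆ζ k (inj₁ ξ′∪η′k) = ξ′∪η′⊆ζ k ξ′∪η′k
      ξ′∪η′∪ξ⊆ζ k (inj₂ ξk) = ξ⊆ζ k ξk
      v≈t : v ≈[ (ξ′ ∪I η′) ∩I ξ ] t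
      v≈t k (inj₁ ξ′k , ξk) = EqD-trans (v≈x k ξ′k) (EqD-trans (EqD-sym (u≈x k (ξ′k , ξk))) (EqD-sym (t≈u k ξk)))
      v≈t k (inj₂ η′k , ξk) = EqD-trans (v≈y k η′k) (EqD-trans (EqD-sym (u≈y k (η′k , ξk))) (EqD-sym (t≈u k ξk)))

    amalgamation : Amalgamation ζ Z
    amalgamation ξ′ η′ ξ′-initial η′-initial ξ′∪η′⊆ζ x y x∈Z↾ξ′ y∈Z↾η′ x≈y =
      let u , Yu , u≈x , u≈y = P'-amalgamation Y∈P' (ξ′ ∩I ξ) (η′ ∩I ξ)
                                 (Initial-∩ ξ′-initial ξ-initial) (Initial-∩ η′-initial ξ-initial) ξ′ξ∪η′ξ⊆ξ
                                 x y (in-Y ξ′ x∈Z↾ξ′) (in-Y η′ y∈Z↾η′) (λ k ((ξ′k , _) , (η′k , _)) → x≈y k (ξ′k , η′k))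
          v , Xv , v≈x , v≈y = P'-amalgamation X∈P' ξ′ η′ ξ′-initial η′-initial ξ′∪η′⊆ζ
                                 x y (Restr-mono ξ′ Z⊆X x x∈Z↾ξ′) (Restr-mono η′ Z⊆X y y∈Z↾η′) x≈y
      in glue ξ′-initial η′-initial ξ′∪η′⊆ζ Yu u≈x u≈y Xv v≈x v≈y
      where
      ξ′ξ∪η′ξ⊆ξ : ((ξ′ ∩I ξ) ∪I (η′ ∩I ξ)) ⊆I ξ
      ξ′ξ∪η′ξ⊆ξ k (inj₁ (_ , ξk)) = ξk
      ξ′ξ∪η′ξ⊆ξ k (inj₂ (_ , ξk)) = ξk
      in-Y : ∀ ξ′ {x} → Restr ξ′ Z x → Restr (ξ′ ∩I ξ) Y x
      in-Y ξ′ (x₀ , Zx₀ , x₀≈x) = x₀ , Z⊆Y x₀ Zx₀ , λ k (ξ′k , _) → x₀≈x k ξ′k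

    Z-P' : P' ζ Z
    Z-P' = mkP' onCoords closed nonempty perfect open′ amalgamation

  Fus-anti : ∀ {X Φ a m k} → m ≤ k → Fus X Φ a k ⊆′ Fus X Φ a m
  Fus-anti {k = zero} z≤n _ x∈ = x∈
  Fus-anti {k = suc k} m≤1+k x x∈ with m≤n⇒m<n∨m≡n m≤1+k
  ... | inj₁ m<1+k = Fus-anti (≤-pred m<1+k) x (proj₁ x∈)
  ... | inj₂ refl = x∈

  module _ {ξ i} {S T : PtSet} (ξ-initial : Initial ξ) (ξi : ξ i) (S↾ξ≐T : Restr ξ S ≐′ T) where

    Sec-Restr : ∀ {z y} → z ≈[ ξ ] y → Sec S i z ≐′ Sec T i y
    Sec-Restr z≈y = (λ _ → to-T) , λ _ → to-S
      where
      z≈<iy = ≈-mono (below-⊆ ξ-initial ξi) z≈y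
      to-T : ∀ {c} → Sec S i _ c → Sec T i _ c
      to-T (x , Sx , x≈z , xi=c) = x , proj₁ S↾ξ≐T x (Restr-self ξ Sx) , ≈-trans x≈z z≈<iy , xi=c
      to-S : ∀ {c} → Sec T i _ c → Sec S i _ c
      to-S (t , Tt , t≈y , ti=c) with proj₂ S↾ξ≐T t Tt
      ... | x , Sx , x≈t = x , Sx , ≈-trans (≈-mono (below-⊆ ξ-initial ξi) x≈t) (≈-trans t≈y (≈-sym z≈<iy)) ,
                           EqD-trans (x≈t i ξi) ti=c

    Restr-SplX-inside : ∀ e → Restr ξ (SplX S i e) ≐′ SplX T i e
    Restr-SplX-inside e = to-T , to-S
      where
      to-T : Restr ξ (SplX S i e) ⊆′ SplX T i e
      to-T y (z , (Sz , Spl-z) , z≈y) =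
        let Ty = proj₁ S↾ξ≐T y (z , Sz , z≈y) in
        Ty , Spl-resp-≐ e (Sec-Restr z≈y) (z≈y i ξi) (Sec-of i Ty ≈-refl) Spl-z
      to-S : SplX T i e ⊆′ Restr ξ (SplX S i e)
      to-S y (Ty , Spl-y) with proj₂ S↾ξ≐T y Ty
      ... | z , Sz , z≈y =
        z , (Sz , Spl-resp-≐ e (swap (Sec-Restr z≈y)) (EqD-sym (z≈y i ξi)) (Sec-of i Sz ≈-refl) Spl-y) , z≈y

  Restr-SplX-outside : ∀ {ζ ξ i} {S T : PtSet} → Initial ζ → P' ζ S → ζ i → Initial ξ → ξ ⊆I ζ → ¬ ξ i →
                       Restr ξ S ≐′ T → ∀ e → Restr ξ (SplX S i e) ≐′ T
  Restr-SplX-outside ζ-initial S∈P' ζi ξ-initial ξ⊆ζ ¬ξi (S↾ξ⊆T , T⊆S↾ξ) e =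
    (λ y (z , (Sz , _) , z≈y) → S↾ξ⊆T y (z , Sz , z≈y)) ,
    λ y Ty → let z , Sz , z≈y = T⊆S↾ξ y Ty ; v , S′v , v≈z = SplX-lift ζ-initial S∈P' ζi e ξ-initial ξ⊆ζ ¬ξi Sz
             in v , S′v , ≈-trans v≈z z≈y

  FiberSubset : SubI → Pt → PtSet → PtSet → Set
  FiberSubset ξ x S T = ∀ w → w ≈[ ξ ] x → S w → T w

  module _ {ζ ξ} (ζ-initial : Initial ζ) (ξ-initial : Initial ξ) (ξ⊆ζ : ξ ⊆I ζ) where

    Sec-fiber : ∀ {S T i x w} → Amalgamation ζ S → ζ i → ¬ ξ i →
                FiberSubset ξ x S T → S w → w ≈[ ξ ] x → Sec S i w ⊆′ Sec T i w
    Sec-fiber {i = i} S-amalgamation ζi ¬ξi S⊆T Sw w≈x _ (t , St , t≈w , ti=c)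
      with amalgamate-atMost S-amalgamation ζ-initial ξ-initial ξ⊆ζ ζi ¬ξi St Sw t≈w
    ... | v , Sv , v≈t , v≈w =
      v , S⊆T v (≈-trans v≈w w≈x) Sv ,
      ≈-trans (≈-mono (below⊆atMost i) v≈t) t≈w , EqD-trans (v≈t i (inj₂ refl)) ti=c

    -- Off ξ the sections over the fibre coincide, so the two splitting bits seen from x must be equal.
    SplX-fiber : ∀ {S T i a b x} → Amalgamation ζ S → Amalgamation ζ T → ζ i →
                 FiberSubset ξ x S T → FiberSubset ξ x T S → SplX S i a x → SplX T i b x →
                 FiberSubset ξ x (SplX S i a) (SplX T i b)
    SplX-fiber {S} {T} {i} {a} {b} {x} S-amalgamation T-amalgamation ζi S⊆T T⊆S S′x T′x w w≈x (Sw , Spl-w)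
      with em {ξ i}
    ... | yes ξi =
      S⊆T w w≈x Sw , Spl-Sec T i b (≈-mono (below-⊆ ξ-initial ξi) (≈-sym w≈x)) (EqD-sym (w≈x i ξi)) (proj₂ T′x)
    ... | no ¬ξi =
      Tw , subst (λ e → Spl (Sec T i w) e (w i)) a≡b
                 (Spl-resp-≐ a (sections Sw w≈x) (λ _ → refl) (Sec-of i Tw ≈-refl) Spl-w)
      where
      Tw = S⊆T w w≈x Sw
      sections : ∀ {v} → S v → v ≈[ ξ ] x → Sec S i v ≐′ Sec T i v
      sections Sv v≈x = Sec-fiber S-amalgamation ζi ¬ξi S⊆T Sv v≈x ,
                        Sec-fiber T-amalgamation ζi ¬ξi T⊆S (S⊆T _ v≈x Sv) v≈x
      a≡b : a ≡ b
      a≡b = Spl-bit-unique (proj₂ S′x)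
              (Spl-resp-≐ b (swap (sections (proj₁ S′x) ≈-refl)) (λ _ → refl) (Sec-of i (proj₁ S′x) ≈-refl) (proj₂ T′x))

  SplX-decide : ∀ {T i x} → T x → PerfectD (Sec T i x) → (d : Dec (SplX T i true x)) → SplX T i (does d) x
  SplX-decide Tx _ (yes x∈) = x∈
  SplX-decide {i = i} {x} Tx T-perfect (no x∉) with splitting-level em T-perfect (Sec-of i Tx ≈-refl)
  ... | l , splits with x i l in xil
  ...   | true = ⊥-elim (x∉ (Tx , Spl-intro l (Sec-of i Tx ≈-refl) splits xil))
  ...   | false = Tx , Spl-intro l (Sec-of i Tx ≈-refl) splits xil

  module Shrinking {ξ ζ X Y} (ξ-initial : Initial ξ) (ζ-initial : Initial ζ) (ξ⊆ζ : ξ ⊆I ζ)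
                   (X∈P : P ζ X) (Y∈P : P ξ Y) (Y⊆X↾ξ : Y ⊆′ Restr ξ X)
                   {Φ} (Φ-admissible : Admissible ζ Φ) (a : ℕ → Bool) where

    open Restriction ξ-initial ζ-initial ξ⊆ζ (proj₁ X∈P) (proj₁ Y∈P) Y⊆X↾ξ using (Z; Z-P'; Z⊆Y; Y⊆Z↾ξ)

    ζΦ : ∀ m → ζ (Φ m)
    ζΦ = proj₁ Φ-admissible

    FZ : ℕ → PtSet
    FZ = Fus Z Φ a

    FZ-P' : ∀ m → P' ζ (FZ m)
    FZ-P' = Fus-P' ζ-initial Z-P' ζΦ a

    ⋂FZ-nonempty : ∃ λ x → ∀ m → FZ m x
    ⋂FZ-nonempty = compactness FZ (λ m → P'-closed (FZ-P' m))
      λ K → let y , FZy = P'-nonempty (FZ-P' K) in y , λ q q<K → Fus-anti (<⇒≤ q<K) y FZy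

    -- On ξ, the fusion of Z along Φ is the fusion of Y along the steps of Φ that land in ξ.
    module _ {i₀} (ξi₀ : ξ i₀) where

      Φ-hits-ξ : ∀ n → ∃ λ m → n ≤ m × ξ (Φ m)
      Φ-hits-ξ n = let m , n≤m , Φm≡i₀ = proj₂ Φ-admissible i₀ (ξ⊆ζ i₀ ξi₀) n in m , n≤m , subst ξ (sym Φm≡i₀) ξi₀

      open Enumeration (λ m → em {ξ (Φ m)}) Φ-hits-ξ

      Φ∘nth-admissible : Admissible ξ (λ k → Φ (nth k))
      Φ∘nth-admissible = Q-nth , λ i ξi n →
        let M , n≤count = count-unbounded n ; m , M≤m , Φm≡i = proj₂ Φ-admissible i (ξ⊆ζ i ξi) M
        in count m , ≤-trans n≤count (count-mono M≤m) , trans (cong Φ (nth-count (subst ξ (sym Φm≡i) ξi))) Φm≡i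

      FY : ℕ → PtSet
      FY = Fus Y (λ k → Φ (nth k)) (λ k → a (nth k))

      FZ↾ξ≐FY : ∀ m → Restr ξ (FZ m) ≐′ FY (count m)
      FZ↾ξ≐FY zero = (λ y (z , Zz , z≈y) → P'-onCoords (proj₁ Y∈P) z y z≈y (Z⊆Y z Zz)) , Y⊆Z↾ξ
      FZ↾ξ≐FY (suc m) with em {ξ (Φ m)}
      ... | yes ξΦm = subst (λ k → Restr ξ (FZ (suc m)) ≐′ SplX (FY (count m)) (Φ k) (a k)) (sym (nth-count ξΦm))
                            (Restr-SplX-inside ξ-initial ξΦm (FZ↾ξ≐FY m) (a m))
      ... | no ¬ξΦm = Restr-SplX-outside ζ-initial (FZ-P' m) (ζΦ m) ξ-initial ξ⊆ζ ¬ξΦm (FZ↾ξ≐FY m) (a m)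

      ⋂FZ⊆⋂FY : ∀ {x} → (∀ m → FZ m x) → ∀ k → FY k x
      ⋂FZ⊆⋂FY x∈ k = let M , k≤count = count-unbounded k in
        Fus-anti k≤count _ (proj₁ (FZ↾ξ≐FY M) _ (Restr-self ξ (x∈ M)))

      ⋂FZ-unique-on-ξ : ∀ {x x′} → (∀ m → FZ m x) → (∀ m → FZ m x′) → x′ ≈[ ξ ] x
      ⋂FZ-unique-on-ξ x∈ x′∈ with proj₂ Y∈P (λ k → Φ (nth k)) Φ∘nth-admissible (λ k → a (nth k))
      ... | _ , _ , unique = ≈-trans (unique _ (⋂FZ⊆⋂FY x′∈)) (≈-sym (unique _ (⋂FZ⊆⋂FY x∈)))

    -- Over the fibre of x, the fusion of Z along Φ is a fusion of X along Φ with suitably chosen bits.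
    module _ {x} (x∈ : ∀ m → FZ m x) where

      chosen : PtSet → I → Bool
      chosen T i = does (em {SplX T i true x})

      T : ℕ → PtSet
      T zero = X
      T (suc m) = SplX (T m) (Φ m) (chosen (T m) (Φ m))

      bits : ℕ → Bool
      bits m = chosen (T m) (Φ m)

      Fus-bits : ∀ m → Fus X Φ bits m ≡ T m
      Fus-bits zero = refl
      Fus-bits (suc m) = cong (λ S → SplX S (Φ m) (bits m)) (Fus-bits m)

      T-P' : ∀ m → P' ζ (T m)
      T-P' m = subst (P' ζ) (Fus-bits m) (Fus-P' ζ-initial (proj₁ X∈P) ζΦ bits m)

      FZ≐T-over-x : ∀ m → FiberSubset ξ x (FZ m) (T m) × FiberSubset ξ x (T m) (FZ m)
      FZ≐T-over-x zero =
        (λ _ _ → proj₁) , λ w w≈x Xw → let _ , u , Yu , x≈u = x∈ 0 in Xw , u , Yu , ≈-trans w≈x x≈u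
      FZ≐T-over-x (suc m) with FZ≐T-over-x m
      ... | FZ⊆T , T⊆FZ =
        SplX-fiber ζ-initial ξ-initial ξ⊆ζ FZ-amalgamation T-amalgamation (ζΦ m) FZ⊆T T⊆FZ (x∈ (suc m)) x∈T′ ,
        SplX-fiber ζ-initial ξ-initial ξ⊆ζ T-amalgamation FZ-amalgamation (ζΦ m) T⊆FZ FZ⊆T x∈T′ (x∈ (suc m))
        where
        FZ-amalgamation = P'-amalgamation (FZ-P' m)
        T-amalgamation = P'-amalgamation (T-P' m)
        x∈T = FZ⊆T x ≈-refl (x∈ m)
        x∈T′ : T (suc m) x
        x∈T′ = SplX-decide x∈T (P'-perfect (T-P' m) (ζΦ m) x (Restr-self _ x∈T)) em

      ⋂FZ-unique-over-x : ∀ {x′} → (∀ m → FZ m x′) → x′ ≈[ ξ ] x → x′ ≈[ ζ ] x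
      ⋂FZ-unique-over-x {x′} x′∈ x′≈x with proj₂ X∈P Φ Φ-admissible bits
      ... | _ , _ , unique = ≈-trans (unique x′ (in-fusion x′ x′≈x x′∈)) (≈-sym (unique x (in-fusion x ≈-refl x∈)))
        where
        in-fusion : ∀ w → w ≈[ ξ ] x → (∀ m → FZ m w) → ∀ m → Fus X Φ bits m w
        in-fusion w w≈x w∈ m = subst (λ S → S w) (sym (Fus-bits m)) (proj₁ (FZ≐T-over-x m) w w≈x (w∈ m))

    ⋂FZ-singleton : ∃ λ x → (∀ m → FZ m x) × (∀ y → (∀ m → FZ m y) → y ≈[ ζ ] x)
    ⋂FZ-singleton = let x , x∈ = ⋂FZ-nonempty in
      x , x∈ , λ y y∈ → ⋂FZ-unique-over-x x∈ y∈ (λ i ξi → ⋂FZ-unique-on-ξ ξi x∈ y∈ i ξi)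

  P-restriction-preimage : ∀ {ξ ζ X Y} → Initial ξ → Initial ζ → ξ ⊆I ζ → P ζ X → P ξ Y → Y ⊆′ Restr ξ X →
                           P ζ (X ∩ Preim ξ Y)
  P-restriction-preimage ξ-initial ζ-initial ξ⊆ζ X∈P Y∈P Y⊆X↾ξ =
    Restriction.Z-P' ξ-initial ζ-initial ξ⊆ζ (proj₁ X∈P) (proj₁ Y∈P) Y⊆X↾ξ ,
    λ Φ Φ-admissible a → Shrinking.⋂FZ-singleton ξ-initial ζ-initial ξ⊆ζ X∈P Y∈P Y⊆X↾ξ Φ-admissible a

lemma5 : ExcludedMiddle 0ℓ →
    (I : Set) (_≺_ : I → I → Set) → IsStrictPartialOrder _≡_ _≺_ →
    (∃ λ (f : I → ℕ) → Injective _≡_ _≡_ f) →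
    let open Setup I _≺_ in
    (ξ ζ : SubI) (X Y : Pt → Set) →
    Initial ξ → Initial ζ → ξ ⊆I ζ →
    P ζ X → P ξ Y → (∀ y → Y y → Restr ξ X y) →
    P ζ (λ x → X x × Preim ξ Y x)
lemma5 em I _≺_ ≺-strict (code , code-injective) _ _ _ _ =
  P-restriction-preimage em I _≺_ ≺-strict code code-injective
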